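{- In the 2-balanced setting described in the context (directions fixed as described, with the first and last adjacencies of $\pi$ positive), if $\pi$ has an MNS, then there exist two boundaries of $\pi$ that are occurrences of the same repeat with different orientations.
   Context: Fix genes $\Sigma_1$ and repeats $\Sigma_2\ni r_0$. A chromosome is a sequence $\pi=[x_0,\dots,x_{n+1}]$ of signed symbols ($x_i=\pm a$, $|x_i|=a$) with $x_0=+r_0$, $x_{n+1}=-r_0$, every gene occurring exactly once. Each occurrence $x_i$ has nodes $l(x_i),r(x_i)$: $(a^h,a^t)$ if $x_i=+a$, $(a^t,a^h)$ if $x_i=-a$. Adjacencies of $\pi$: the unordered pairs $\langle r(x_i),l(x_{i+1})\rangle$, $0\le i\le n$; $\mathcal{A}[\pi]$ is their multiset; $\pi$ is simple if no adjacency occurs twice. 2-balanced setting: $\pi=[x_0,\dots,x_{n+1}]$ and $\tau=[y_0,\dots,y_{n+1}]$ are simple related chromosomes with $\mathcal{A}[\pi]=\mathcal{A}[\tau]$, every repeat occurring exactly twice in each, and for every repeat $r$, $\tau$ contains both $+r$ and $-r$. Identical adjacencies are matched by the unique bijection. If $\langle r(x_i),l(x_{i+1})\rangle$ is matched to $\langle r(y_j),l(y_{j+1})\rangle$, it is positive if $r(x_i)=r(y_j)\ne l(x_{i+1})=l(y_{j+1})$, negative if $r(x_i)=l(y_{j+1})\ne l(x_{i+1})=r(y_j)$, and entangled if all four nodes coincide; each entangled adjacency gets the direction of its two neighbouring adjacencies. An MNS (MPS) is a maximal run of consecutive negative (positive) adjacencies of $\pi$. An occurrence $x_i$, $1\le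 i\le n$, is a boundary if its left adjacency $\langle r(x_{i-1}),l(x_i)\rangle$ and right adjacency $\langle r(x_i),l(x_{i+1})\rangle$ have different directions. -}

module Defs where

open import Data.Nat using (ℕ; zero; suc; _≤_)
open import Data.Fin using (Fin; zero; suc; toℕ; inject₁; fromℕ)
open import Data.Sum using (_⊎_; inj₁; inj₂)
open import Data.Product using (Σ; ∃; ∃-syntax; _×_; _,_; proj₁; proj₂)
open import Relation.Binary.PropositionalEquality using (_≡_; _≢_)
open import Relation.Nullary using (¬_)
open import Function.Definitions using (Bijective)

data Sign : Set where
  ⊕ ⊖ : Sign

data End : Set where
  hd tl : End

-- Symbols: genes G (Σ₁) and repeats R (Σ₂), disjoint.
Sym : Set → Set → Set
Sym G R = G ⊎ R

record SSym (G R : Set) : Set where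
  constructor _·_
  field
    sign : Sign
    sym  : Sym G R
open SSym public

Node : Set → Set → Set
Node G R = Sym G R × End

module _ {G R : Set} where

  lnode : SSym G R → Node G R
  lnode (⊕ · a) = a , hd
  lnode (⊖ · a) = a , tl

  rnode : SSym G R → Node G R
  rnode (⊕ · a) = a , tl
  rnode (⊖ · a) = a , hd

  -- Equality of unordered pairs of nodes (represented as ordered pairs).
  _≈ᵤ_ : Node G R × Node G R → Node G R × Node G R → Set
  (a , b) ≈ᵤ (c , d) = (a ≡ c × b ≡ d) ⊎ (a ≡ d × b ≡ c)

-- A sequence [x₀,…,x_{n+1}] of signed symbols.
Seq : Set → Set → ℕ → Set
Seq G R n = Fin (suc (suc n)) → SSym G R

module _ {G R : Set} {n : ℕ} where

  adj : Seq G R n → Fin (suc n) → Node G R × Node G R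
  adj π k = rnode (π (inject₁ k)) , lnode (π (suc k))

  record Chromosome2 (r₀ : R) (π : Seq G R n) : Set where
    field
      first      : π zero ≡ (⊕ · inj₂ r₀)
      last       : π (fromℕ (suc n)) ≡ (⊖ · inj₂ r₀)
      geneOcc    : ∀ (g : G) → ∃[ i ] sym (π i) ≡ inj₁ g
      geneUnique : ∀ (g : G) (i j : Fin (suc (suc n))) →
                   sym (π i) ≡ inj₁ g → sym (π j) ≡ inj₁ g → i ≡ j
      repTwice   : ∀ (r : R) → ∃[ i ] ∃[ j ] (i ≢ j × sym (π i) ≡ inj₂ r × sym (π j) ≡ inj₂ r
                   × (∀ k → sym (π k) ≡ inj₂ r → k ≡ i ⊎ k ≡ j))

  Simple : Seq G R n → Set
  Simple π = ∀ (k k' : Fin (suc n)) → adj π k ≈ᵤ adj π k' → k ≡ k'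

  -- The 2-balanced setting; σ is the bijection matching identical adjacencies
  -- (adjacency k of π is matched to adjacency σ k of τ); this witnesses 𝒜[π] = 𝒜[τ].
  record TwoBalanced (r₀ : R) (π τ : Seq G R n) (σ : Fin (suc n) → Fin (suc n)) : Set where
    field
      chrπ     : Chromosome2 r₀ π
      chrτ     : Chromosome2 r₀ τ
      simpleπ  : Simple π
      simpleτ  : Simple τ
      σ-bij    : Bijective _≡_ _≡_ σ
      σ-match  : ∀ k → adj π k ≈ᵤ adj τ (σ k)
      τ-both   : ∀ (r : R) → (∃[ i ] τ i ≡ (⊕ · inj₂ r)) × (∃[ j ] τ j ≡ (⊖ · inj₂ r))

  module Directions (π τ : Seq G R n) (σ : Fin (suc n) → Fin (suc n)) where

    RawPos : Fin (suc n) → Set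
    RawPos k = proj₁ (adj π k) ≡ proj₁ (adj τ (σ k)) × proj₂ (adj π k) ≡ proj₂ (adj τ (σ k))
               × proj₁ (adj π k) ≢ proj₂ (adj π k)

    RawNeg : Fin (suc n) → Set
    RawNeg k = proj₁ (adj π k) ≡ proj₂ (adj τ (σ k)) × proj₂ (adj π k) ≡ proj₁ (adj τ (σ k))
               × proj₁ (adj π k) ≢ proj₂ (adj π k)

    RawEnt : Fin (suc n) → Set
    RawEnt k = proj₁ (adj π k) ≡ proj₂ (adj π k) × proj₂ (adj π k) ≡ proj₁ (adj τ (σ k))
               × proj₁ (adj τ (σ k)) ≡ proj₂ (adj τ (σ k))

    IsPos : Fin (suc n) → Set
    IsPos k = RawPos k ⊎ (RawEnt k × ∃[ kl ] ∃[ kr ]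
                (suc (toℕ kl) ≡ toℕ k × suc (toℕ k) ≡ toℕ kr × RawPos kl × RawPos kr))

    IsNeg : Fin (suc n) → Set
    IsNeg k = RawNeg k ⊎ (RawEnt k × ∃[ kl ] ∃[ kr ]
                (suc (toℕ kl) ≡ toℕ k × suc (toℕ k) ≡ toℕ kr × RawNeg kl × RawNeg kr))

    MNS : Fin (suc n) → Fin (suc n) → Set
    MNS a b = toℕ a ≤ toℕ b
            × (∀ k → toℕ a ≤ toℕ k → toℕ k ≤ toℕ b → IsNeg k)
            × (∀ k → suc (toℕ k) ≡ toℕ a → ¬ IsNeg k)
            × (∀ k → suc (toℕ b) ≡ toℕ k → ¬ IsNeg k)

    Boundary : Fin (suc (suc n)) → Set
    Boundary i = ∃[ kl ] ∃[ kr ] (suc (toℕ kl) ≡ toℕ i × toℕ kr ≡ toℕ i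
                 × ((IsPos kl × IsNeg kr) ⊎ (IsNeg kl × IsPos kr)))

-- Match every adjacency of π to its partner in τ and give it a direction, entangled
-- adjacencies inheriting the direction of their predecessor.  Reading an adjacency k
-- with direction d locates the occurrence x_{k+1} at position σ k + 1 (d positive) or
-- σ k (d negative) of τ.  Since σ is a permutation fixing the first adjacency, these
-- positions can only be pairwise distinct if no adjacency is negative (compare the sums
-- of the positions).  An MNS therefore forces two occurrences x_{k+1}, x_{k'+1} to be
-- read at the same position of τ, once positively and once negatively: they are the
-- same repeat with opposite signs.  As a repeat occurs only twice in π, neither
-- occurrence is entangled with a neighbour, and the direction changes across each.
module Submission where

open import Defs
open import Algebra.Properties.CommutativeMonoid.Sum as Sum using ()
open import Data.Bool using (Bool; true; false; not) renaming (_≟_ to _≟ᵇ_)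
open import Data.Bool.Properties using (¬-not; not-¬)
open import Data.Empty using (⊥)
open import Data.Fin as Fin using (Fin; zero; suc; toℕ; inject₁; fromℕ; lower₁; punchOut)
open import Data.Fin.Permutation using (Permutation; permutation)
open import Data.Fin.Properties as Finₚ using (any?; _≟_)
open import Data.Nat using (ℕ; zero; suc; _+_; _≤_)
open import Data.Nat.Properties as ℕₚ using (+-0-commutativeMonoid)
open import Data.Product using (∃; ∃₂; ∃-syntax; _×_; _,_; proj₁; proj₂)
open import Data.Sum using (_⊎_; inj₁; inj₂)
open import Function using (_∘_)
open import Function.Definitions using (Injective)
open import Relation.Binary.PropositionalEquality as ≡ hiding (sym)
open import Relation.Nullary using (¬_; Dec; yes; no; contradiction)
open import Relation.Nullary.Decidable using (_×-dec_; ¬?)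

open Sum +-0-commutativeMonoid using (sum; sum-permute; sum-remove; sum-cong-≗; ∑-distrib-+)

pattern pos = true
pattern neg = false

collision-or-injective : ∀ {m m'} (f : Fin m → Fin m') →
                         (∃₂ λ k k' → k ≢ k' × f k ≡ f k') ⊎ Injective _≡_ _≡_ f
collision-or-injective f
  with any? (λ k → any? (λ k' → ¬? (k ≟ k') ×-dec (f k ≟ f k')))
... | yes collision = inj₁ collision
... | no none       = inj₂ injective
  where
  injective : Injective _≡_ _≡_ f
  injective {k} {k'} fk≡fk' with k ≟ k'
  ... | yes k≡k' = k≡k'
  ... | no  k≢k' = contradiction (k , k' , k≢k' , fk≡fk') none

injective⇒surjective : ∀ {m} {f : Fin m → Fin m} → Injective _≡_ _≡_ f → ∀ y → ∃ λ x → f x ≡ y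
injective⇒surjective {zero}  _     ()
injective⇒surjective {suc m} {f} f-inj y with any? (λ x → f x ≟ y)
... | yes hit = hit
... | no miss = contradiction (Finₚ.injective⇒≤ avoid-inj) ℕₚ.1+n≰n
  where
  f≢y : ∀ x → y ≢ f x
  f≢y x y≡fx = miss (x , ≡.sym y≡fx)
  avoid : Fin (suc m) → Fin m
  avoid x = punchOut (f≢y x)
  avoid-inj : Injective _≡_ _≡_ avoid
  avoid-inj {x} {x'} eq = f-inj (Finₚ.punchOut-injective (f≢y x) (f≢y x') eq)

sum-toℕ-injective : ∀ {m} {f : Fin m → Fin m} → Injective _≡_ _≡_ f →
                    sum (toℕ ∘ f) ≡ sum {m} toℕ
sum-toℕ-injective {m} {f} f-inj = ≡.sym (sum-permute toℕ asPermutation)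
  where
  preimage : ∀ y → ∃ λ x → f x ≡ y
  preimage = injective⇒surjective f-inj
  asPermutation : Permutation m m
  asPermutation = permutation f (proj₁ ∘ preimage) (proj₂ ∘ preimage)
                              (λ x → f-inj (proj₂ (preimage (f x))))

sum≡0⇒≡0 : ∀ {m} (ε : Fin m → ℕ) → sum ε ≡ 0 → ∀ k → ε k ≡ 0
sum≡0⇒≡0 {suc m} ε sum≡0 k = ℕₚ.n≤0⇒n≡0 (subst (ε k ≤_) sum≡0 εk≤sum)
  where
  εk≤sum : ε k ≤ sum ε
  εk≤sum = subst (ε k ≤_) (≡.sym (sum-remove {i = k} ε)) (ℕₚ.m≤m+n _ _)

injective-offset≡0 : ∀ {m} {f g : Fin m → Fin m} (ε : Fin m → ℕ) →
                     Injective _≡_ _≡_ f → Injective _≡_ _≡_ g →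
                     (∀ k → toℕ (f k) ≡ toℕ (g k) + ε k) → ∀ k → ε k ≡ 0
injective-offset≡0 {m} {f} {g} ε f-inj g-inj f≡g+ε = sum≡0⇒≡0 ε (ℕₚ.+-cancelˡ-≡ _ _ _ sums)
  where
  open ≡-Reasoning
  sums : sum (toℕ ∘ g) + sum ε ≡ sum (toℕ ∘ g) + 0
  sums = begin
    sum (toℕ ∘ g) + sum ε       ≡⟨ ∑-distrib-+ (toℕ ∘ g) ε ⟨
    sum (λ k → toℕ (g k) + ε k) ≡⟨ sum-cong-≗ f≡g+ε ⟨
    sum (toℕ ∘ f)               ≡⟨ sum-toℕ-injective f-inj ⟩
    sum {m} toℕ                 ≡⟨ sum-toℕ-injective g-inj ⟨
    sum (toℕ ∘ g)               ≡⟨ ℕₚ.+-identityʳ _ ⟨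
    sum (toℕ ∘ g) + 0           ∎

shift : ∀ {m} → Bool → Fin m → Fin (suc m)
shift pos = suc
shift neg = inject₁

shift-injective : ∀ {m} b {x y : Fin m} → shift b x ≡ shift b y → x ≡ y
shift-injective pos = Finₚ.suc-injective
shift-injective neg = Finₚ.inject₁-injective

module _ {m : ℕ} {f : Fin (suc m) → Fin (suc m)} (f-inj : Injective _≡_ _≡_ f) (d : Fin (suc m) → Bool)
         (neg⇒nonzero : ∀ k → d k ≡ neg → f k ≢ zero) where

  shifted-injective⇒all-pos : Injective _≡_ _≡_ (λ k → shift (d k) (f k)) → ∀ k → d k ≡ pos
  shifted-injective⇒all-pos shifted-inj k = offset≡0⇒pos (d k) (offset≡0 k)
    where
    unshift : Bool → Fin (suc m) → Fin (suc m)
    unshift pos x = x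
    unshift neg x = Fin.pred x

    offset : Bool → ℕ
    offset pos = 0
    offset neg = 1

    offset≡0⇒pos : ∀ b → offset b ≡ 0 → b ≡ pos
    offset≡0⇒pos pos _ = refl

    shift-unshift : ∀ b (x : Fin (suc m)) → (b ≡ neg → x ≢ zero) →
                    toℕ (shift b x) ≡ suc (toℕ (unshift b x)) × toℕ x ≡ toℕ (unshift b x) + offset b
    shift-unshift pos x         _       = refl , ≡.sym (ℕₚ.+-identityʳ _)
    shift-unshift neg zero      nonzero = contradiction refl (nonzero refl)
    shift-unshift neg (suc x)   _       =
      refl , trans (cong suc (≡.sym (Finₚ.toℕ-inject₁ x))) (ℕₚ.+-comm 1 _)

    unshifted : Fin (suc m) → Fin (suc m)
    unshifted k = unshift (d k) (f k)

    unshift-facts : ∀ k → toℕ (shift (d k) (f k)) ≡ suc (toℕ (unshifted k))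
                        × toℕ (f k) ≡ toℕ (unshifted k) + offset (d k)
    unshift-facts k = shift-unshift (d k) (f k) (neg⇒nonzero k)

    unshifted-inj : Injective _≡_ _≡_ unshifted
    unshifted-inj {k} {k'} eq = shifted-inj (Finₚ.toℕ-injective (begin
      toℕ (shift (d k) (f k))     ≡⟨ proj₁ (unshift-facts k) ⟩
      suc (toℕ (unshifted k))     ≡⟨ cong (suc ∘ toℕ) eq ⟩
      suc (toℕ (unshifted k'))    ≡⟨ proj₁ (unshift-facts k') ⟨
      toℕ (shift (d k') (f k'))   ∎))
      where open ≡-Reasoning

    offset≡0 : ∀ k → offset (d k) ≡ 0
    offset≡0 = injective-offset≡0 (offset ∘ d) f-inj unshifted-inj (proj₂ ∘ unshift-facts)

inject₁≢suc : ∀ {m} (x : Fin m) → inject₁ x ≢ suc x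
inject₁≢suc x eq = ℕₚ.1+n≢n (trans (≡.sym (cong toℕ eq)) (Finₚ.toℕ-inject₁ x))

inject₁²≢suc² : ∀ {m} (x : Fin m) → inject₁ (inject₁ x) ≢ suc (suc x)
inject₁²≢suc² x eq = ℕₚ.m≢1+n+m (toℕ x) (begin
  toℕ x                     ≡⟨ Finₚ.toℕ-inject₁ x ⟨
  toℕ (inject₁ x)           ≡⟨ Finₚ.toℕ-inject₁ (inject₁ x) ⟨
  toℕ (inject₁ (inject₁ x)) ≡⟨ cong toℕ eq ⟩
  suc (suc (toℕ x))         ∎)
  where open ≡-Reasoning

inject₁≡zero : ∀ {m} {x : Fin (suc m)} → inject₁ x ≡ zero → x ≡ zero
inject₁≡zero {x = zero} _ = refl

flipSign : Sign → Sign
flipSign ⊕ = ⊖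
flipSign ⊖ = ⊕

s≢flipSign-s : ∀ s → s ≢ flipSign s
s≢flipSign-s ⊕ ()
s≢flipSign-s ⊖ ()

two-of-three-equal : ∀ {X : Set} {a b c i j : X} →
                     a ≡ i ⊎ a ≡ j → b ≡ i ⊎ b ≡ j → c ≡ i ⊎ c ≡ j → a ≡ b ⊎ a ≡ c ⊎ b ≡ c
two-of-three-equal (inj₁ a≡i) (inj₁ b≡i) _          = inj₁ (trans a≡i (≡.sym b≡i))
two-of-three-equal (inj₂ a≡j) (inj₂ b≡j) _          = inj₁ (trans a≡j (≡.sym b≡j))
two-of-three-equal (inj₁ a≡i) (inj₂ _)   (inj₁ c≡i) = inj₂ (inj₁ (trans a≡i (≡.sym c≡i)))
two-of-three-equal (inj₁ _)   (inj₂ b≡j) (inj₂ c≡j) = inj₂ (inj₂ (trans b≡j (≡.sym c≡j)))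
two-of-three-equal (inj₂ _)   (inj₁ b≡i) (inj₁ c≡i) = inj₂ (inj₂ (trans b≡i (≡.sym c≡i)))
two-of-three-equal (inj₂ a≡j) (inj₁ _)   (inj₂ c≡j) = inj₂ (inj₁ (trans a≡j (≡.sym c≡j)))

Aligned : ∀ {A : Set} → Bool → A × A → A × A → Set
Aligned pos (p , p') (t , t') = p ≡ t  × p' ≡ t'
Aligned neg (p , p') (t , t') = p ≡ t' × p' ≡ t

aligned-unique : ∀ {A : Set} {b b' : Bool} {p p' t t' : A} → p ≢ p' →
                 Aligned b (p , p') (t , t') → Aligned b' (p , p') (t , t') → b ≡ b'
aligned-unique {b = pos} {pos} _     _         _          = refl
aligned-unique {b = pos} {neg} p≢p' (p≡t , _) (_ , p'≡t)  = contradiction (trans p≡t (≡.sym p'≡t)) p≢p'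
aligned-unique {b = neg} {pos} p≢p' (_ , p'≡t) (p≡t , _)  = contradiction (trans p≡t (≡.sym p'≡t)) p≢p'
aligned-unique {b = neg} {neg} _     _         _          = refl

aligned-degenerate : ∀ {A : Set} {b b' : Bool} {p p' t t' : A} → p ≡ p' →
                     Aligned b (p , p') (t , t') → Aligned b' (p , p') (t , t')
aligned-degenerate {b = pos} {pos} _    aligned     = aligned
aligned-degenerate {b = pos} {neg} p≡p' (p≡t , p'≡t') = trans p≡p' p'≡t' , trans (≡.sym p≡p') p≡t
aligned-degenerate {b = neg} {pos} p≡p' (p≡t' , p'≡t) = trans p≡p' p'≡t , trans (≡.sym p≡p') p≡t'
aligned-degenerate {b = neg} {neg} _    aligned     = aligned

≈ᵤ⇒aligned : ∀ {G R : Set} {u v : Node G R × Node G R} → u ≈ᵤ v → ∃[ b ] Aligned b u v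
≈ᵤ⇒aligned {u = _ , _} {_ , _} (inj₁ aligned) = pos , aligned
≈ᵤ⇒aligned {u = _ , _} {_ , _} (inj₂ aligned) = neg , aligned

module _ {G R : Set} where

  infix 8 -_
  -_ : SSym G R → SSym G R
  - x = flipSign (sign x) · sym x

  orient : Bool → SSym G R → SSym G R
  orient pos x = x
  orient neg x = - x

  lnode-injective : ∀ {x y : SSym G R} → lnode x ≡ lnode y → x ≡ y
  lnode-injective {⊕ · _} {⊕ · _} refl = refl
  lnode-injective {⊖ · _} {⊖ · _} refl = refl

  rnode-injective : ∀ {x y : SSym G R} → rnode x ≡ rnode y → x ≡ y
  rnode-injective {⊕ · _} {⊕ · _} refl = refl
  rnode-injective {⊖ · _} {⊖ · _} refl = refl

  lnode-neg : ∀ (x : SSym G R) → lnode (- x) ≡ rnode x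
  lnode-neg (⊕ · _) = refl
  lnode-neg (⊖ · _) = refl

  rnode-neg : ∀ (x : SSym G R) → rnode (- x) ≡ lnode x
  rnode-neg (⊕ · _) = refl
  rnode-neg (⊖ · _) = refl

  rnode≡lnode⇒neg : ∀ {x y : SSym G R} → rnode x ≡ lnode y → x ≡ - y
  rnode≡lnode⇒neg {y = y} eq = rnode-injective (trans eq (≡.sym (rnode-neg y)))

  lnode≡rnode⇒neg : ∀ {x y : SSym G R} → lnode x ≡ rnode y → x ≡ - y
  lnode≡rnode⇒neg {y = y} eq = lnode-injective (trans eq (≡.sym (lnode-neg y)))

  neg-involutive : ∀ (x : SSym G R) → - - x ≡ x
  neg-involutive (⊕ · _) = refl
  neg-involutive (⊖ · _) = refl

  orient-injective : ∀ b {x y : SSym G R} → orient b x ≡ orient b y → x ≡ y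
  orient-injective pos eq = eq
  orient-injective neg {x} {y} eq =
    trans (≡.sym (neg-involutive x)) (trans (cong -_ eq) (neg-involutive y))

  orient-not : ∀ b (x : SSym G R) → orient (not b) x ≡ - orient b x
  orient-not pos x = refl
  orient-not neg x = ≡.sym (neg-involutive x)

module _ {G R : Set} {r₀ : R} {n : ℕ} {ρ : Seq G R n} (chr : Chromosome2 r₀ ρ) where
  open Chromosome2 chr

  at-most-two : ∀ {a b c} → sym (ρ a) ≡ sym (ρ b) → sym (ρ a) ≡ sym (ρ c) →
                a ≡ b ⊎ a ≡ c ⊎ b ≡ c
  at-most-two {a} {b} {c} ab ac with sym (ρ a) in ρa
  ... | inj₁ g = inj₁ (geneUnique g a b ρa (≡.sym ab))
  ... | inj₂ r with repTwice r
  ...   | _ , _ , _ , _ , _ , only =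
    two-of-three-equal (only a ρa) (only b (≡.sym ab)) (only c (≡.sym ac))

  opposite⇒repeat : ∀ {i j} → i ≢ j → ρ j ≡ - ρ i →
                    ∃[ r ] ∃[ s ] ∃[ s' ] (s ≢ s' × ρ i ≡ (s · inj₂ r) × ρ j ≡ (s' · inj₂ r))
  opposite⇒repeat {i} {j} i≢j ρj with ρ i in ρi
  ... | s · inj₁ g = contradiction (geneUnique g i j (cong sym ρi) (cong sym ρj)) i≢j
  ... | s · inj₂ r = r , s , flipSign s , s≢flipSign-s s , refl , ρj

module Matching {G R : Set} (r₀ : R) (n : ℕ) (π τ : Seq G R n) (σ : Fin (suc n) → Fin (suc n))
                (tb : TwoBalanced r₀ π τ σ) where
  open TwoBalanced tb
  open Directions π τ σ

  σ-injective : Injective _≡_ _≡_ σ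
  σ-injective = proj₁ σ-bij

  opposite-in-τ : ∀ s r → ∃[ c ] τ c ≡ - (s · inj₂ r)
  opposite-in-τ ⊕ r = proj₂ (τ-both r)
  opposite-in-τ ⊖ r = proj₁ (τ-both r)

  τ-injective : ∀ {a b} → τ a ≡ τ b → a ≡ b
  τ-injective {a} {b} τa≡τb with sym (τ a) in τa
  ... | inj₁ g = Chromosome2.geneUnique chrτ g a b τa (trans (cong sym (≡.sym τa≡τb)) τa)
  ... | inj₂ r with opposite-in-τ (sign (τ a)) r
  ...   | c , τc = among (at-most-two chrτ (cong sym τa≡τb) (trans τa (≡.sym (cong sym τc))))
    where
    excluded : ∀ {d} → τ d ≡ τ a → d ≢ c
    excluded τd≡τa refl = s≢flipSign-s (sign (τ a)) (cong sign (trans (≡.sym τd≡τa) τc))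
    among : a ≡ b ⊎ a ≡ c ⊎ b ≡ c → a ≡ b
    among (inj₁ a≡b)        = a≡b
    among (inj₂ (inj₁ a≡c)) = contradiction a≡c (excluded refl)
    among (inj₂ (inj₂ b≡c)) = contradiction b≡c (excluded (≡.sym τa≡τb))

  Matched : Bool → Fin (suc n) → Set
  Matched b k = Aligned b (adj π k) (adj τ (σ k))

  Entangled : Fin (suc n) → Set
  Entangled k = proj₁ (adj π k) ≡ proj₂ (adj π k)

  entangled⇒opposite : ∀ {k} → Entangled k → π (inject₁ k) ≡ - π (suc k)
  entangled⇒opposite = rnode≡lnode⇒neg

  matched-unique : ∀ {b b' k} → ¬ Entangled k → Matched b k → Matched b' k → b ≡ b'
  matched-unique = aligned-unique

  -- The position of τ holding x_{k+1}, up to sign, when adjacency k is read in direction b.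
  readPos : Bool → Fin (suc n) → Fin (suc (suc n))
  readPos b k = shift b (σ k)

  readPos-injective : ∀ b {k k'} → readPos b k ≡ readPos b k' → k ≡ k'
  readPos-injective b = σ-injective ∘ shift-injective b

  matched-left : ∀ b {k} → Matched b k → π (inject₁ k) ≡ orient b (τ (readPos (not b) k))
  matched-left pos (r≡r , _) = rnode-injective r≡r
  matched-left neg (r≡l , _) = rnode≡lnode⇒neg r≡l

  matched-right : ∀ b {k} → Matched b k → π (suc k) ≡ orient b (τ (readPos b k))
  matched-right pos (_ , l≡l) = lnode-injective l≡l
  matched-right neg (_ , l≡r) = lnode≡rnode⇒neg l≡r

  same-read⇒opposite : ∀ {b b' k k'} → Matched b k → Matched b' k' → b ≢ b' →
                       readPos b k ≡ readPos b' k' → π (suc k') ≡ - π (suc k)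
  same-read⇒opposite {b} {b'} {k} {k'} m m' b≢b' same = begin
    π (suc k')                         ≡⟨ matched-right b' m' ⟩
    orient b' (τ (readPos b' k'))      ≡⟨ cong (λ d → orient d _) (¬-not (b≢b' ∘ ≡.sym)) ⟩
    orient (not b) (τ (readPos b' k')) ≡⟨ orient-not b _ ⟩
    - orient b (τ (readPos b' k'))     ≡⟨ cong (λ p → - orient b (τ p)) same ⟨
    - orient b (τ (readPos b k))       ≡⟨ cong -_ (matched-right b m) ⟨
    - π (suc k)                        ∎
    where open ≡-Reasoning

  same-read⇒entangled : ∀ {b b' j} → Matched b (inject₁ j) → Matched b' (suc j) →
                        readPos b (inject₁ j) ≡ readPos b' (suc j) → Entangled (suc j)
  same-read⇒entangled {b} {b'} {j} m m' same =
    trans (≡.sym (lnode-neg _)) (cong lnode (≡.sym (same-read⇒opposite m m' b≢b' same)))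
    where
    b≢b' : b ≢ b'
    b≢b' refl = inject₁≢suc j (readPos-injective b same)

  entangled⇒same-read : ∀ {b b' j} → Matched b (inject₁ j) → Matched b' (suc j) → b ≢ b' →
                        Entangled (suc j) → readPos b (inject₁ j) ≡ readPos b' (suc j)
  entangled⇒same-read {b} {b'} {j} m m' b≢b' ent = τ-injective (orient-injective b (begin
    orient b (τ (readPos b (inject₁ j)))      ≡⟨ matched-right b m ⟨
    π (inject₁ (suc j))                       ≡⟨ entangled⇒opposite ent ⟩
    - π (suc (suc j))                         ≡⟨ cong -_ (matched-right b' m') ⟩
    - orient b' (τ (readPos b' (suc j)))      ≡⟨ cong (λ d → - orient d _) (¬-not (b≢b' ∘ ≡.sym)) ⟩
    - orient (not b) (τ (readPos b' (suc j))) ≡⟨ cong -_ (orient-not b _) ⟩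
    - - orient b (τ (readPos b' (suc j)))     ≡⟨ neg-involutive _ ⟩
    orient b (τ (readPos b' (suc j)))         ∎))
    where open ≡-Reasoning

  rawDir : Fin (suc n) → Bool
  rawDir k = proj₁ (≈ᵤ⇒aligned (σ-match k))

  rawDir-matched : ∀ k → Matched (rawDir k) k
  rawDir-matched k = proj₂ (≈ᵤ⇒aligned (σ-match k))

  RawCollision : Fin n → Set
  RawCollision j = readPos (rawDir (inject₁ j)) (inject₁ j) ≡ readPos (rawDir (suc j)) (suc j)

  rawCollision? : ∀ j → Dec (RawCollision j)
  rawCollision? j = _ ≟ _

  -- Entanglement is not decidable (nodes have no decidable equality), but by
  -- same-read⇒entangled and entangled⇒same-read a raw collision detects exactly the
  -- entangled adjacencies whose raw direction disagrees with their predecessor's.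
  dir : Fin (suc n) → Bool
  dir zero = rawDir zero
  dir (suc j) with rawCollision? j
  ... | yes _ = rawDir (inject₁ j)
  ... | no  _ = rawDir (suc j)

  dir-matched : ∀ k → Matched (dir k) k
  dir-matched zero = rawDir-matched zero
  dir-matched (suc j) with rawCollision? j
  ... | yes collision = aligned-degenerate
                          (same-read⇒entangled (rawDir-matched _) (rawDir-matched _) collision)
                          (rawDir-matched (suc j))
  ... | no  _ = rawDir-matched (suc j)

  dir-unentangled : ∀ {k} → ¬ Entangled k → dir k ≡ rawDir k
  dir-unentangled {k} ¬ent = matched-unique ¬ent (dir-matched k) (rawDir-matched k)

  no-consecutive-entangled : ∀ {j} → Entangled (inject₁ j) → Entangled (suc j) → ⊥
  no-consecutive-entangled {j} ent ent' with at-most-two chrπ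
      (≡.sym (cong sym (entangled⇒opposite ent))) (cong sym (entangled⇒opposite ent'))
  ... | inj₁ eq        = inject₁≢suc (inject₁ j) (≡.sym eq)
  ... | inj₂ (inj₁ eq) = inject₁≢suc j (Finₚ.suc-injective eq)
  ... | inj₂ (inj₂ eq) = inject₁²≢suc² j eq

  dir-before-entangled : ∀ {j} → Entangled (suc j) → dir (inject₁ j) ≡ rawDir (inject₁ j)
  dir-before-entangled ent = dir-unentangled (λ ent' → no-consecutive-entangled ent' ent)

  dir-entangled : ∀ {j} → Entangled (suc j) → dir (suc j) ≡ dir (inject₁ j)
  dir-entangled {j} ent with rawCollision? j
  ... | yes _ = ≡.sym (dir-before-entangled ent)
  ... | no ¬collision with rawDir (inject₁ j) ≟ᵇ rawDir (suc j)
  ...   | yes same   = ≡.sym (trans (dir-before-entangled ent) same)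
  ...   | no  differ = contradiction
          (entangled⇒same-read (rawDir-matched _) (rawDir-matched _) differ ent) ¬collision

  Directed : Bool → Fin (suc n) → Set
  Directed pos = IsPos
  Directed neg = IsNeg

  unentangled-directed : ∀ {k} → ¬ Entangled k → Directed (dir k) k
  unentangled-directed {k} ¬ent = directed (dir k) (dir-matched k)
    where
    directed : ∀ b → Matched b k → Directed b k
    directed pos (e₁ , e₂) = inj₁ (e₁ , e₂ , ¬ent)
    directed neg (e₁ , e₂) = inj₁ (e₁ , e₂ , ¬ent)

  boundary : ∀ {i kl kr b b'} → suc (toℕ kl) ≡ toℕ i → toℕ kr ≡ toℕ i → b ≢ b' →
             Directed b kl → Directed b' kr → Boundary i
  boundary {b = pos} {pos} _  _  b≢b' _  _  = contradiction refl b≢b'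
  boundary {b = pos} {neg} il ir _    dl dr = _ , _ , il , ir , inj₁ (dl , dr)
  boundary {b = neg} {pos} il ir _    dl dr = _ , _ , il , ir , inj₂ (dl , dr)
  boundary {b = neg} {neg} _  _  b≢b' _  _  = contradiction refl b≢b'

  first-positive : IsPos zero → dir zero ≡ pos × σ zero ≡ zero
  first-positive (inj₁ (e₁ , e₂ , ¬ent)) =
    matched-unique ¬ent (dir-matched zero) (e₁ , e₂) ,
    inject₁≡zero (τ-injective (begin
      τ (inject₁ (σ zero)) ≡⟨ matched-left pos (e₁ , e₂) ⟨
      π zero               ≡⟨ Chromosome2.first chrπ ⟩
      ⊕ · inj₂ r₀          ≡⟨ Chromosome2.first chrτ ⟨
      τ zero               ∎))
    where open ≡-Reasoning
  first-positive (inj₂ (_ , _ , _ , () , _))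

  rawNeg⇒dir-neg : ∀ {k} → RawNeg k → dir k ≡ neg
  rawNeg⇒dir-neg {k} (e₁ , e₂ , ¬ent) = matched-unique ¬ent (dir-matched k) (e₁ , e₂)

  isNeg⇒some-dir-neg : ∀ {k} → IsNeg k → ∃[ k' ] dir k' ≡ neg
  isNeg⇒some-dir-neg {k} (inj₁ rawNeg)                        = k  , rawNeg⇒dir-neg rawNeg
  isNeg⇒some-dir-neg (inj₂ (_ , kl , _ , _ , _ , rawNeg , _)) = kl , rawNeg⇒dir-neg rawNeg

  rightEnd : Fin (suc n) → Fin (suc (suc n))
  rightEnd k = readPos (dir k) k

  Collision : Fin (suc n) → Fin (suc n) → Set
  Collision k k' = k ≢ k' × rightEnd k ≡ rightEnd k'

  collision-sym : ∀ {k k'} → Collision k k' → Collision k' k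
  collision-sym (k≢k' , same) = k≢k' ∘ ≡.sym , ≡.sym same

  collision-exists : IsPos zero → (∃[ a ] ∃[ b ] MNS a b) → ∃[ k ] ∃[ k' ] Collision k k'
  collision-exists first-pos (a , _ , a≤b , all-neg , _)
    with first-positive first-pos | isNeg⇒some-dir-neg (all-neg a ℕₚ.≤-refl a≤b)
       | collision-or-injective rightEnd
  ... | _ , _       | _ , _       | inj₁ collision = collision
  ... | dir-0 , σ-0 | k₀ , dir-k₀ | inj₂ injective = contradiction
          (trans (≡.sym (shifted-injective⇒all-pos σ-injective dir neg⇒nonzero injective k₀)) dir-k₀)
          λ ()
    where
    neg⇒nonzero : ∀ k → dir k ≡ neg → σ k ≢ zero
    neg⇒nonzero k dir-k σk≡0 with σ-injective (trans σk≡0 (≡.sym σ-0))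
    ... | refl = contradiction (trans (≡.sym dir-k) dir-0) λ ()

  collision-dirs : ∀ {k k'} → Collision k k' → dir k ≢ dir k'
  collision-dirs {k} {k'} (k≢k' , same) same-dir =
    k≢k' (readPos-injective (dir k) (trans same (cong (λ d → readPos d k') (≡.sym same-dir))))

  collision-opposite : ∀ {k k'} → Collision k k' → π (suc k') ≡ - π (suc k)
  collision-opposite {k} {k'} c@(_ , same) =
    same-read⇒opposite (dir-matched k) (dir-matched k') (collision-dirs c) same

  collision-not-last : ∀ {k k'} → Collision k k' → n ≢ toℕ k
  collision-not-last {k} {k'} c@(k≢k' , _) n≡k =
    among (at-most-two chrπ {zero} {suc k} {suc k'}
             first≡last (trans first≡last (≡.sym (cong sym (collision-opposite c)))))
    where
    last : k ≡ fromℕ n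
    last = Finₚ.toℕ-injective (trans (≡.sym n≡k) (≡.sym (Finₚ.toℕ-fromℕ n)))
    first≡last : sym (π zero) ≡ sym (π (suc k))
    first≡last = trans (cong sym (Chromosome2.first chrπ))
                       (≡.sym (trans (cong (sym ∘ π ∘ suc) last) (cong sym (Chromosome2.last chrπ))))
    among : zero ≡ suc k ⊎ zero ≡ suc k' ⊎ suc k ≡ suc k' → ⊥
    among (inj₁ ())
    among (inj₂ (inj₁ ()))
    among (inj₂ (inj₂ eq)) = k≢k' (Finₚ.suc-injective eq)

  collision⇒repeat : ∀ {k k'} → Collision k k' →
                     ∃[ r ] ∃[ s ] ∃[ s' ] (s ≢ s' × π (suc k) ≡ (s · inj₂ r) × π (suc k') ≡ (s' · inj₂ r))
  collision⇒repeat c@(k≢k' , _) =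
    opposite⇒repeat chrπ (k≢k' ∘ Finₚ.suc-injective) (collision-opposite c)

  entangled-dir : ∀ {k k'} → Entangled k → inject₁ k ≡ suc k' → dir k ≡ dir k'
  entangled-dir {suc j} ent eq = trans (dir-entangled ent) (cong dir (Finₚ.suc-injective eq))

  collision-unentangled : ∀ {k k'} → Collision k k' → ¬ Entangled k
  collision-unentangled {k} {k'} c@(k≢k' , _) ent with at-most-two chrπ {suc k} {inject₁ k} {suc k'}
      (≡.sym (cong sym (entangled⇒opposite ent))) (≡.sym (cong sym (collision-opposite c)))
  ... | inj₁ eq        = inject₁≢suc k (≡.sym eq)
  ... | inj₂ (inj₁ eq) = k≢k' (Finₚ.suc-injective eq)
  ... | inj₂ (inj₂ eq) = collision-dirs c (entangled-dir ent eq)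

  read-through-both-sides : ∀ b {j} → Matched b (inject₁ j) → Matched b (suc j) →
                            readPos (not b) (suc j) ≡ readPos b (inject₁ j)
  read-through-both-sides b m m' =
    τ-injective (orient-injective b (trans (≡.sym (matched-left b m')) (matched-right b m)))

  collision-next-dir : ∀ {j k'} → Collision (inject₁ j) k' → dir (suc j) ≢ dir (inject₁ j)
  collision-next-dir {j} {k'} c@(_ , same) next≡ = not-¬ refl (begin
    b           ≡⟨ next≡ ⟨
    dir (suc j) ≡⟨ cong dir next≡k' ⟩
    dir k'      ≡⟨ dir-k' ⟩
    not b       ∎)
    where
    open ≡-Reasoning
    b : Bool
    b = dir (inject₁ j)
    dir-k' : dir k' ≡ not b
    dir-k' = ¬-not (collision-dirs c ∘ ≡.sym)
    next≡k' : suc j ≡ k'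
    next≡k' = readPos-injective (not b) (begin
      readPos (not b) (suc j) ≡⟨ read-through-both-sides b (dir-matched _)
                                   (subst (λ d → Matched d (suc j)) next≡ (dir-matched (suc j))) ⟩
      readPos b (inject₁ j)   ≡⟨ same ⟩
      readPos (dir k') k'     ≡⟨ cong (λ d → readPos d k') dir-k' ⟩
      readPos (not b) k'      ∎)

  collision⇒boundary : ∀ {k k'} → Collision k k' → Boundary (suc k)
  collision⇒boundary {k} c
    with lower₁ k (collision-not-last c) | Finₚ.inject₁-lower₁ k (collision-not-last c)
  ... | j | refl =
    boundary refl (cong suc (≡.sym (Finₚ.toℕ-inject₁ j))) (collision-next-dir c ∘ ≡.sym)
             (unentangled-directed (collision-unentangled c))
             (unentangled-directed (collision-next-dir c ∘ dir-entangled))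

theorem6 : {G R : Set} (r₀ : R) (n : ℕ) (π τ : Seq G R n) (σ : Fin (suc n) → Fin (suc n)) →
    TwoBalanced r₀ π τ σ →
    Directions.IsPos π τ σ zero →
    Directions.IsPos π τ σ (fromℕ n) →
    (∃[ a ] ∃[ b ] Directions.MNS π τ σ a b) →
    ∃[ i ] ∃[ j ] ∃[ r ] ∃[ s ] ∃[ s' ]
      (s ≢ s' × π i ≡ (s · inj₂ r) × π j ≡ (s' · inj₂ r)
       × Directions.Boundary π τ σ i × Directions.Boundary π τ σ j)
theorem6 r₀ n π τ σ tb first-pos _ mns =
  let open Matching r₀ n π τ σ tb
      k , k' , c = collision-exists first-pos mns
      r , s , s' , s≢s' , πk , πk' = collision⇒repeat c
  in suc k , suc k' , r , s , s' , s≢s' , πk , πk' ,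
     collision⇒boundary c , collision⇒boundary (collision-sym c)
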